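{- Let $n>3$. The edge set of the complete graph $K_n$ can be partitioned into $\lceil 3n/4\rceil$ $2$-star-forests, and it cannot be partitioned into fewer than $\lceil 3n/4\rceil$ $2$-star-forests.
   Context: A star is a graph consisting of a vertex together with some edges incident to it (a single vertex counts as a star). A star-forest is a graph every connected component of which is a star. A $k$-star-forest is a star-forest with at most $k$ connected components. -}

module Defs where

open import Data.Nat using (ℕ; _+_; _*_)
open import Data.Nat.DivMod using (_/_)
open import Data.Fin using (Fin)
open import Data.Product using (Σ; _×_)
open import Data.Sum using (_⊎_)
open import Data.Empty using (⊥)
open import Relation.Nullary using (¬_)
open import Relation.Binary.PropositionalEquality using (_≡_; _≢_)

Disjoint : ∀ {n} → Fin n → Fin n → Fin n → Fin n → Set
Disjoint u v u' v' = (u ≢ u') × (u ≢ v') × (v ≢ u') × (v ≢ v')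

-- The graph formed by the edge set E is a k-star-forest: it is a vertex-disjoint
-- union of at most k stars.
IsStarForestOfSize : ∀ {n} (k : ℕ) → (Fin n → Fin n → Set) → Set
IsStarForestOfSize {n} k E =
  Σ (Fin k → Fin n) λ center →
  Σ ((u v : Fin n) → E u v → Fin k) λ assign →
    ((u v : Fin n) (e : E u v) → (u ≡ center (assign u v e)) ⊎ (v ≡ center (assign u v e)))
    × ((u v u' v' : Fin n) (e : E u v) (e' : E u' v') →
         assign u v e ≢ assign u' v' e' → Disjoint u v u' v')

ColourClass : ∀ {n m} → (Fin n → Fin n → Fin m) → Fin m → Fin n → Fin n → Set
ColourClass c i u v = (u ≢ v) × (c u v ≡ i)

PartitionableInto2StarForests : ℕ → ℕ → Set
PartitionableInto2StarForests n m =
  Σ (Fin n → Fin n → Fin m) λ c →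
    ((u v : Fin n) → u ≢ v → c u v ≡ c v u)
    × ((i : Fin m) → IsStarForestOfSize 2 (ColourClass c i))

ceil3n/4 : ℕ → ℕ
ceil3n/4 n = (3 * n + 3) / 4

-- The bound is attained by splitting the vertices into k blocks of four and r < 4 leftover
-- vertices and using 3k + r = ⌈3n/4⌉ forests.  Each leftover vertex is the centre of a star of its
-- own forest, holding its edges to all block vertices and to the smaller leftover vertices.  Each
-- block carries three forests with both star centres in the block: inside the block they are the
-- three perfect matchings of K₄, and a vertex of an earlier block is joined to three vertices of
-- a later block through the later block's forests and to the fourth one through a star of its own
-- block centred at itself.  Every vertex is given a side of every forest so that each edge lies on
-- one side together with the centre of that side; this makes the two stars of a forest disjoint.
--
-- For the lower bound call x a centre of forest i if x is the centre of a nonempty star of i; two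
-- distinct centres of i are never endpoints of touching edges of colour i.  If some vertex z is a
-- centre of no forest, every edge vz lies in a star centred at v, so the edges at z have distinct
-- colours and n ≤ m + 1.  Otherwise give every forest four tokens, one per star and two spare
-- ones, and let every vertex claim three of them: the tokens of three of its stars; or, if it is a
-- centre of exactly one forest (at most one vertex per forest is), the two spare tokens of that
-- forest and its star token; or, if it is a centre of exactly two forests, its two star tokens and
-- a spare token of one of them left unclaimed by the previous rule.  No token is claimed twice, so
-- 3n ≤ 4m.

module Submission where

open import Defs
open import Data.Nat using (ℕ; zero; suc; _+_; _*_; _≤_; _<_; s≤s; s≤s⁻¹)
open import Data.Nat.Properties
  using (n<1+n; +-comm; *-suc; +-monoˡ-≤; +-monoʳ-≤; +-cancelʳ-≤; *-monoˡ-≤; module ≤-Reasoning)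
open import Data.Nat.DivMod
  using (_/_; _%_; m<n*o⇒m/o<n; +-distrib-/-∣ˡ; m*n/n≡m; m≡m%n+[m/n]*n; m%n<n)
open import Data.Nat.Divisibility using (divides-refl)
open import Data.Nat.Tactic.RingSolver using (solve-∀)
open import Data.Fin using (Fin; zero; suc; _≟_)
open import Data.Fin.Patterns
open import Data.Fin.Properties using (any?; injective⇒≤; suc-injective; *↔×; +↔⊎)
open import Data.List using (List; []; _∷_; [_]; filter; allFin)
import Data.List.Properties as List
open import Data.List.Membership.Propositional using (_∈_)
open import Data.List.Membership.Propositional.Properties using (∈-filter⁺; ∈-filter⁻; ∈-allFin)
open import Data.List.Relation.Unary.Any using (here; there)
open import Data.List.Relation.Unary.All using (_∷_)
open import Data.List.Relation.Unary.AllPairs using (_∷_)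
open import Data.List.Relation.Unary.Unique.Propositional using (Unique)
open import Data.List.Relation.Unary.Unique.Propositional.Properties using (filter⁺; allFin⁺)
open import Data.Product using (Σ; ∃; _×_; _,_; proj₁; proj₂; uncurry)
open import Data.Product.Function.NonDependent.Propositional using (_×-↔_)
open import Data.Sum using (_⊎_; inj₁; inj₂; swap)
open import Data.Sum.Properties using (inj₁-injective; inj₂-injective)
open import Data.Sum.Function.Propositional using (_⊎-↔_)
open import Data.Empty using (⊥; ⊥-elim)
open import Function using (_∘_; Inverse; Injection; _↔_; _↣_; mk↣)
open import Function.Definitions using (Injective)
open import Function.Construct.Composition using (_↔-∘_; _↣-∘_)
open import Function.Construct.Identity using (↔-id)
open import Function.Construct.Symmetry using (↔-sym)
open import Function.Properties.Inverse using (↔⇒↣)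
open import Relation.Nullary using (¬_; Dec; yes; no)
open import Relation.Nullary.Decidable using (map′; ¬?; decidable-stable)
open import Relation.Binary.PropositionalEquality hiding ([_])

ceil3n/4-least : ∀ {n m} → n * 3 ≤ m * 4 → ceil3n/4 n ≤ m
ceil3n/4-least {n} {m} n*3≤m*4 = s≤s⁻¹ (m<n*o⇒m/o<n (begin-strict
  3 * n + 3        <⟨ n<1+n _ ⟩
  1 + (3 * n + 3)  ≡⟨ regroup n ⟩
  n * 3 + 4        ≤⟨ +-monoˡ-≤ 4 n*3≤m*4 ⟩
  m * 4 + 4        ≡⟨ +-comm (m * 4) 4 ⟩
  suc m * 4        ∎))
  where
  open ≤-Reasoning
  regroup : ∀ n → 1 + (3 * n + 3) ≡ n * 3 + 4
  regroup = solve-∀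

n≤1+m⇒n*3≤m*4 : ∀ {n m} → 3 < n → n ≤ suc m → n * 3 ≤ m * 4
n≤1+m⇒n*3≤m*4 {n} {m} 3<n n≤1+m = +-cancelʳ-≤ 4 (n * 3) (m * 4) (begin
  n * 3 + 4    ≤⟨ +-monoʳ-≤ (n * 3) 3<n ⟩
  n * 3 + n    ≡⟨ +-comm (n * 3) n ⟩
  n + n * 3    ≡⟨ *-suc n 3 ⟨
  n * 4        ≤⟨ *-monoˡ-≤ 4 n≤1+m ⟩
  suc m * 4    ≡⟨ +-comm 4 (m * 4) ⟩
  m * 4 + 4    ∎)
  where
  open ≤-Reasoning

ceil3n/4-blocks : ∀ k r → r < 4 → ceil3n/4 (k * 4 + r) ≡ k * 3 + r
ceil3n/4-blocks k r r<4 = begin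
  (3 * (k * 4 + r) + 3) / 4       ≡⟨ cong (_/ 4) (regroup k r) ⟩
  (k * 3 * 4 + (3 * r + 3)) / 4   ≡⟨ +-distrib-/-∣ˡ (3 * r + 3) (divides-refl (k * 3)) ⟩
  k * 3 * 4 / 4 + (3 * r + 3) / 4 ≡⟨ cong₂ _+_ (m*n/n≡m (k * 3) 4) (digit r r<4) ⟩
  k * 3 + r                       ∎
  where
  open ≡-Reasoning
  regroup : ∀ k r → 3 * (k * 4 + r) + 3 ≡ k * 3 * 4 + (3 * r + 3)
  regroup = solve-∀
  digit : ∀ r → r < 4 → (3 * r + 3) / 4 ≡ r
  digit 0 _ = refl
  digit 1 _ = refl
  digit 2 _ = refl
  digit 3 _ = refl
  digit (suc (suc (suc (suc _)))) (s≤s (s≤s (s≤s (s≤s ()))))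

n≡blocks : ∀ n → n ≡ n / 4 * 4 + n % 4
n≡blocks n = trans (m≡m%n+[m/n]*n n 4) (+-comm (n % 4) (n / 4 * 4))

InStar : ∀ {V : Set} {k} → (V → Fin k) → (Fin k → V) → V → V → Set
InStar side centre x y = side x ≡ side y × (x ≡ centre (side x) ⊎ y ≡ centre (side x))

InStar-sym : ∀ {V : Set} {k} {side : V → Fin k} {centre : Fin k → V} {x y} →
  InStar side centre x y → InStar side centre y x
InStar-sym {centre = centre} (sides , inj₁ p) = sym sides , inj₂ (trans p (cong centre sides))
InStar-sym {centre = centre} (sides , inj₂ q) = sym sides , inj₁ (trans q (cong centre sides))

isStarForest-bySides : ∀ {n k} {E : Fin n → Fin n → Set}
  (side : Fin n → Fin k) (centre : Fin k → Fin n) →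
  (∀ {u v} → E u v → InStar side centre u v) → IsStarForestOfSize k E
isStarForest-bySides side centre inStar =
  centre , (λ u _ _ → side u) , (λ _ _ e → proj₂ (inStar e)) , disjoint
  where
  disjoint : ∀ u v u′ v′ e e′ → side u ≢ side u′ → Disjoint u v u′ v′
  disjoint u v u′ v′ e e′ sides≢ =
    (λ { refl → sides≢ refl }) ,
    (λ { refl → sides≢ (sym (proj₁ (inStar e′))) }) ,
    (λ { refl → sides≢ (proj₁ (inStar e)) }) ,
    (λ { refl → sides≢ (trans (proj₁ (inStar e)) (sym (proj₁ (inStar e′)))) })

InStar-retract : ∀ {V W : Set} {k} {side : W → Fin k} {centre : Fin k → W}
  (f : V → W) (g : W → V) → (∀ x → g (f x) ≡ x) → ∀ {x y} →
  InStar side centre (f x) (f y) → InStar (side ∘ f) (g ∘ centre) x y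
InStar-retract f g gf {x} {y} (sides , inj₁ p) = sides , inj₁ (trans (sym (gf x)) (cong g p))
InStar-retract f g gf {x} {y} (sides , inj₂ q) = sides , inj₂ (trans (sym (gf y)) (cong g q))

record SidedPartition (V F : Set) : Set where
  field
    colour     : V → V → F
    colour-sym : ∀ x y → colour x y ≡ colour y x
    side       : F → V → Fin 2
    centre     : F → Fin 2 → V
    inStar     : ∀ {x y} → x ≢ y → InStar (side (colour x y)) (centre (colour x y)) x y

partitionable : ∀ {N M} {V F : Set} → Fin N ↔ V → Fin M ↔ F →
  SidedPartition V F → PartitionableInto2StarForests N M
partitionable {N} {M} {F = Forest} vertices forests P =
  colouring , (λ u v _ → cong F.from (colour-sym (V.to u) (V.to v))) , classes
  where
  open SidedPartition P
  module V = Inverse vertices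
  module F = Inverse forests
  colouring : Fin N → Fin N → Fin M
  colouring u v = F.from (colour (V.to u) (V.to v))
  classes : ∀ i → IsStarForestOfSize 2 (ColourClass colouring i)
  classes i = isStarForest-bySides (side (F.to i) ∘ V.to) (V.from ∘ centre (F.to i)) inStar′
    where
    inStar′ : ∀ {u v} → ColourClass colouring i u v →
      InStar (side (F.to i) ∘ V.to) (V.from ∘ centre (F.to i)) u v
    inStar′ {u} {v} (u≢v , refl) rewrite F.strictlyInverseˡ (colour (V.to u) (V.to v)) =
      InStar-retract {side = side c} {centre c} V.to V.from V.strictlyInverseʳ
        (inStar (u≢v ∘ Injection.injective (↔⇒↣ vertices)))
      where
      c : Forest
      c = colour (V.to u) (V.to v)

data Position : Set where
  before same after : Position

position : ∀ {k} → Fin k → Fin k → Position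
position zero    zero    = same
position zero    (suc _) = before
position (suc _) zero    = after
position (suc s) (suc t) = position s t

position-refl : ∀ {k} (s : Fin k) → position s s ≡ same
position-refl zero    = refl
position-refl (suc s) = position-refl s

position-same : ∀ {k} (s t : Fin k) → position s t ≡ same → s ≡ t
position-same zero    zero    _ = refl
position-same (suc s) (suc t) p = cong suc (position-same s t p)

position-before : ∀ {k} (s t : Fin k) → position s t ≡ before → position t s ≡ after
position-before zero    (suc t) _ = refl
position-before (suc s) (suc t) p = position-before s t p

position-after : ∀ {k} (s t : Fin k) → position s t ≡ after → position t s ≡ before
position-after (suc s) zero    _ = refl
position-after (suc s) (suc t) p = position-after s t p

larger : ∀ {r} → Fin r → Fin r → Fin r
larger i i′ with position i i′
... | before = i′
... | _      = i

larger-sym : ∀ {r} (i i′ : Fin r) → larger i i′ ≡ larger i′ i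
larger-sym i i′ with position i i′ in eq
... | before rewrite position-before i i′ eq = refl
... | after  rewrite position-after i i′ eq = refl
... | same with refl ← position-same i i′ eq rewrite position-refl i = refl

larger-sel : ∀ {r} (i i′ : Fin r) → larger i i′ ≡ i ⊎ larger i i′ ≡ i′
larger-sel i i′ with position i i′
... | before = inj₂ refl
... | same   = inj₁ refl
... | after  = inj₁ refl

-- Forest f of a block has its stars centred at the block vertices centreIn f 0F and centreIn f 1F;
-- within j j′ is the forest of the edge jj′ inside the block.
centreIn : Fin 3 → Fin 2 → Fin 4
centreIn 0F 0F = 0F
centreIn 0F 1F = 1F
centreIn 1F 0F = 2F
centreIn 1F 1F = 3F
centreIn 2F 0F = 0F
centreIn 2F 1F = 2F

within : Fin 4 → Fin 4 → Fin 3
within 0F 2F = 0F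
within 2F 0F = 0F
within 1F 3F = 0F
within 3F 1F = 0F
within 0F 3F = 1F
within 3F 0F = 1F
within 1F 2F = 1F
within 2F 1F = 1F
within 0F 1F = 2F
within 1F 0F = 2F
within 2F 3F = 2F
within 3F 2F = 2F
within _  _  = 0F

data Host : Set where
  earlier later : Host

-- The forest of the edge from vertex j of an earlier block to vertex j′ of a later block.
cross : Fin 4 → Fin 4 → Host × Fin 3
cross 0F 0F = later , 0F
cross 2F 0F = later , 0F
cross 1F 0F = later , 2F
cross 3F 0F = later , 2F
cross 0F 2F = later , 2F
cross 2F 2F = later , 2F
cross 1F 2F = later , 1F
cross 3F 2F = later , 1F
cross 1F 1F = later , 0F
cross 3F 1F = later , 0F
cross 0F 3F = later , 1F
cross 2F 3F = later , 1F
cross 0F 1F = earlier , 0F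
cross 2F 1F = earlier , 1F
cross 1F 3F = earlier , 0F
cross 3F 3F = earlier , 1F

-- blockSide p f j is the side of forest f of block t containing vertex j of block b, where
-- p = position b t; entries for vertices on no edge of the forest are arbitrary.
blockSide : Position → Fin 3 → Fin 4 → Fin 2
blockSide same   0F 0F = 0F
blockSide same   0F 1F = 1F
blockSide same   0F 2F = 0F
blockSide same   0F 3F = 1F
blockSide same   1F 0F = 1F
blockSide same   1F 1F = 0F
blockSide same   1F 2F = 0F
blockSide same   1F 3F = 1F
blockSide same   2F 0F = 0F
blockSide same   2F 1F = 0F
blockSide same   2F 2F = 1F
blockSide same   2F 3F = 1F
blockSide before 0F 0F = 0F
blockSide before 0F 1F = 1F
blockSide before 0F 2F = 0F
blockSide before 0F 3F = 1F
blockSide before 1F 0F = 1F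
blockSide before 1F 1F = 0F
blockSide before 1F 2F = 1F
blockSide before 1F 3F = 0F
blockSide before 2F 0F = 1F
blockSide before 2F 1F = 0F
blockSide before 2F 2F = 1F
blockSide before 2F 3F = 0F
blockSide after  0F 3F = 1F
blockSide after  1F 3F = 1F
blockSide after  _  _  = 0F

within-sym : ∀ j j′ → within j j′ ≡ within j′ j
within-sym 0F 0F = refl
within-sym 0F 1F = refl
within-sym 0F 2F = refl
within-sym 0F 3F = refl
within-sym 1F 0F = refl
within-sym 1F 1F = refl
within-sym 1F 2F = refl
within-sym 1F 3F = refl
within-sym 2F 0F = refl
within-sym 2F 1F = refl
within-sym 2F 2F = refl
within-sym 2F 3F = refl
within-sym 3F 0F = refl
within-sym 3F 1F = refl
within-sym 3F 2F = refl
within-sym 3F 3F = refl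

within-inStar : ∀ j j′ → j ≢ j′ → InStar (blockSide same (within j j′)) (centreIn (within j j′)) j j′
within-inStar 0F 0F j≢j′ = ⊥-elim (j≢j′ refl)
within-inStar 1F 1F j≢j′ = ⊥-elim (j≢j′ refl)
within-inStar 2F 2F j≢j′ = ⊥-elim (j≢j′ refl)
within-inStar 3F 3F j≢j′ = ⊥-elim (j≢j′ refl)
within-inStar 0F 1F _ = refl , inj₁ refl
within-inStar 0F 2F _ = refl , inj₁ refl
within-inStar 0F 3F _ = refl , inj₂ refl
within-inStar 1F 0F _ = refl , inj₂ refl
within-inStar 1F 2F _ = refl , inj₂ refl
within-inStar 1F 3F _ = refl , inj₁ refl
within-inStar 2F 0F _ = refl , inj₂ refl
within-inStar 2F 1F _ = refl , inj₁ refl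
within-inStar 2F 3F _ = refl , inj₁ refl
within-inStar 3F 0F _ = refl , inj₁ refl
within-inStar 3F 1F _ = refl , inj₂ refl
within-inStar 3F 2F _ = refl , inj₂ refl

CrossInStar : Fin 4 → Fin 4 → Host × Fin 3 → Set
CrossInStar j j′ (later , f) =
  blockSide before f j ≡ blockSide same f j′ × j′ ≡ centreIn f (blockSide same f j′)
CrossInStar j j′ (earlier , f) =
  blockSide same f j ≡ blockSide after f j′ × j ≡ centreIn f (blockSide same f j)

cross-inStar : ∀ j j′ → CrossInStar j j′ (cross j j′)
cross-inStar 0F 0F = refl , refl
cross-inStar 0F 1F = refl , refl
cross-inStar 0F 2F = refl , refl
cross-inStar 0F 3F = refl , refl
cross-inStar 1F 0F = refl , refl
cross-inStar 1F 1F = refl , refl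
cross-inStar 1F 2F = refl , refl
cross-inStar 1F 3F = refl , refl
cross-inStar 2F 0F = refl , refl
cross-inStar 2F 1F = refl , refl
cross-inStar 2F 2F = refl , refl
cross-inStar 2F 3F = refl , refl
cross-inStar 3F 0F = refl , refl
cross-inStar 3F 1F = refl , refl
cross-inStar 3F 2F = refl , refl
cross-inStar 3F 3F = refl , refl

module BlockConstruction (k r : ℕ) where

  Vertex : Set
  Vertex = (Fin k × Fin 4) ⊎ Fin r

  Forest : Set
  Forest = (Fin k × Fin 3) ⊎ Fin r

  host : Fin k → Fin k → Host × Fin 3 → Forest
  host s t (earlier , f) = inj₁ (s , f)
  host s t (later   , f) = inj₁ (t , f)

  blockColour : Position → Fin k → Fin 4 → Fin k → Fin 4 → Forest
  blockColour before s j t j′ = host s t (cross j j′)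
  blockColour same   s j t j′ = inj₁ (t , within j j′)
  blockColour after  s j t j′ = host t s (cross j′ j)

  colour : Vertex → Vertex → Forest
  colour (inj₁ (s , j)) (inj₁ (t , j′)) = blockColour (position s t) s j t j′
  colour (inj₁ _)       (inj₂ i)        = inj₂ i
  colour (inj₂ i)       (inj₁ _)        = inj₂ i
  colour (inj₂ i)       (inj₂ i′)       = inj₂ (larger i i′)

  side : Forest → Vertex → Fin 2
  side (inj₁ (t , f)) (inj₁ (b , j)) = blockSide (position b t) f j
  side _              _              = 0F

  centre : Forest → Fin 2 → Vertex
  centre (inj₁ (t , f)) a = inj₁ (t , centreIn f a)
  centre (inj₂ i)       _ = inj₂ i

  Sided : Vertex → Vertex → Set
  Sided x y = InStar (side (colour x y)) (centre (colour x y)) x y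

  blockColour-sym : ∀ s t j j′ →
    blockColour (position s t) s j t j′ ≡ blockColour (position t s) t j′ s j
  blockColour-sym s t j j′ with position s t in eq
  ... | before rewrite position-before s t eq = refl
  ... | after  rewrite position-after s t eq = refl
  ... | same with refl ← position-same s t eq rewrite position-refl s =
    cong (λ f → inj₁ (s , f)) (within-sym j j′)

  colour-sym : ∀ x y → colour x y ≡ colour y x
  colour-sym (inj₁ (s , j)) (inj₁ (t , j′)) = blockColour-sym s t j j′
  colour-sym (inj₁ _)       (inj₂ i)        = refl
  colour-sym (inj₂ i)       (inj₁ _)        = refl
  colour-sym (inj₂ i)       (inj₂ i′)       = cong inj₂ (larger-sym i i′)

  cross-sided : ∀ s t j j′ → position s t ≡ before →
    InStar (side (host s t (cross j j′))) (centre (host s t (cross j j′)))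
      (inj₁ (s , j)) (inj₁ (t , j′))
  cross-sided s t j j′ s-before-t with cross j j′ | cross-inStar j j′
  ... | later , f | sides , centred
    rewrite s-before-t | position-refl t =
      sides , inj₂ (cong (λ j → inj₁ (t , j)) (trans centred (cong (centreIn f) (sym sides))))
  ... | earlier , f | sides , centred
    rewrite position-before s t s-before-t | position-refl s =
      sides , inj₁ (cong (λ j → inj₁ (s , j)) centred)

  sided : ∀ {x y} → x ≢ y → Sided x y
  sided {inj₁ (s , j)} {inj₁ (t , j′)} x≢y with position s t in eq
  ... | before = cross-sided s t j j′ eq
  ... | after  = InStar-sym {side = side c} {centre c} (cross-sided t s j′ j (position-after s t eq))
    where
    c : Forest
    c = host t s (cross j′ j)
  ... | same with refl ← position-same s t eq rewrite position-refl s
    with within-inStar j j′ (λ { refl → x≢y refl })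
  ...   | sides , inj₁ p = sides , inj₁ (cong (λ j → inj₁ (s , j)) p)
  ...   | sides , inj₂ q = sides , inj₂ (cong (λ j → inj₁ (s , j)) q)
  sided {inj₁ _}  {inj₂ i}  _ = refl , inj₂ refl
  sided {inj₂ i}  {inj₁ _}  _ = refl , inj₁ refl
  sided {inj₂ i}  {inj₂ i′} _ with larger-sel i i′
  ... | inj₁ p = refl , inj₁ (cong inj₂ (sym p))
  ... | inj₂ q = refl , inj₂ (cong inj₂ (sym q))

  blockPartition : SidedPartition Vertex Forest
  blockPartition = record
    { colour = colour ; colour-sym = colour-sym ; side = side ; centre = centre ; inStar = sided }

  vertices : Fin (k * 4 + r) ↔ Vertex
  vertices = (*↔× ⊎-↔ ↔-id _) ↔-∘ +↔⊎

  forests : Fin (k * 3 + r) ↔ Forest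
  forests = (*↔× ⊎-↔ ↔-id _) ↔-∘ +↔⊎

blocks-partitionable : ∀ k r → PartitionableInto2StarForests (k * 4 + r) (k * 3 + r)
blocks-partitionable k r = partitionable vertices forests blockPartition
  where open BlockConstruction k r

partitionable-ceil3n/4 : ∀ n → PartitionableInto2StarForests n (ceil3n/4 n)
partitionable-ceil3n/4 n =
  subst (λ x → PartitionableInto2StarForests x (ceil3n/4 x)) (sym (n≡blocks n))
    (subst (PartitionableInto2StarForests _) (sym (ceil3n/4-blocks (n / 4) (n % 4) (m%n<n n 4)))
      (blocks-partitionable (n / 4) (n % 4)))

claims-injective : ∀ {A B C : Set} (Claims : A → B → Set) →
  (∀ {a a′ b} → Claims a b → Claims a′ b → a ≡ a′) →
  (g : A → C → B) → (∀ a → Injective _≡_ _≡_ (g a)) → (∀ a c → Claims a (g a c)) →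
  Injective _≡_ _≡_ (uncurry g)
claims-injective Claims functional g g-injective claimed {a , c} {a′ , c′} eq
  with refl ← functional (claimed a c) (subst (Claims a′) (sym eq) (claimed a′ c′)) =
  cong (a ,_) (g-injective a eq)

three : ∀ {B : Set} → B → B → B → Fin 3 → B
three a b c 0F = a
three a b c 1F = b
three a b c 2F = c

three-injective : ∀ {B : Set} {a b c : B} → a ≢ b → a ≢ c → b ≢ c → Injective _≡_ _≡_ (three a b c)
three-injective a≢b a≢c b≢c {0F} {0F} _ = refl
three-injective a≢b a≢c b≢c {0F} {1F} p = ⊥-elim (a≢b p)
three-injective a≢b a≢c b≢c {0F} {2F} p = ⊥-elim (a≢c p)
three-injective a≢b a≢c b≢c {1F} {0F} p = ⊥-elim (a≢b (sym p))
three-injective a≢b a≢c b≢c {1F} {1F} _ = refl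
three-injective a≢b a≢c b≢c {1F} {2F} p = ⊥-elim (b≢c p)
three-injective a≢b a≢c b≢c {2F} {0F} p = ⊥-elim (a≢c (sym p))
three-injective a≢b a≢c b≢c {2F} {1F} p = ⊥-elim (b≢c (sym p))
three-injective a≢b a≢c b≢c {2F} {2F} _ = refl

module Centres {n m : ℕ} (c : Fin n → Fin n → Fin m)
  (c-sym : ∀ u v → u ≢ v → c u v ≡ c v u)
  (forest : ∀ i → IsStarForestOfSize 2 (ColourClass c i)) where

  Edge : Fin m → Fin n → Fin n → Set
  Edge = ColourClass c

  centre : Fin m → Fin 2 → Fin n
  centre i = proj₁ (forest i)

  star : ∀ {i x y} → Edge i x y → Fin 2
  star {i} {x} {y} = proj₁ (proj₂ (forest i)) x y

  star-centred : ∀ {i x y} (e : Edge i x y) → x ≡ centre i (star e) ⊎ y ≡ centre i (star e)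
  star-centred {i} {x} {y} = proj₁ (proj₂ (proj₂ (forest i))) x y

  Touch : Fin n → Fin n → Fin n → Fin n → Set
  Touch x y x′ y′ = (x ≡ x′ ⊎ x ≡ y′) ⊎ (y ≡ x′ ⊎ y ≡ y′)

  touching-sameStar : ∀ {i x y x′ y′} → Touch x y x′ y′ →
    (e : Edge i x y) (e′ : Edge i x′ y′) → star e ≡ star e′
  touching-sameStar {i} {x} {y} {x′} {y′} touch e e′ with star e ≟ star e′
  ... | yes sameStar = sameStar
  ... | no differ with proj₂ (proj₂ (proj₂ (forest i))) x y x′ y′ e e′ differ | touch
  ...   | x≢x′ , _ , _ , _ | inj₁ (inj₁ p) = ⊥-elim (x≢x′ p)
  ...   | _ , x≢y′ , _ , _ | inj₁ (inj₂ p) = ⊥-elim (x≢y′ p)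
  ...   | _ , _ , y≢x′ , _ | inj₂ (inj₁ p) = ⊥-elim (y≢x′ p)
  ...   | _ , _ , _ , y≢y′ | inj₂ (inj₂ p) = ⊥-elim (y≢y′ p)

  Edge-flip : ∀ {i x y} → Edge i x y → Edge i y x
  Edge-flip {x = x} {y} (x≢y , refl) = (x≢y ∘ sym) , sym (c-sym x y x≢y)

  -- The edge is needed: the centre of an empty star is arbitrary.
  IsCentre : Fin m → Fin n → Set
  IsCentre i x = ∃ λ y → Σ (Edge i x y) λ e → x ≡ centre i (star e)

  starOf : ∀ {i x} → IsCentre i x → Fin 2
  starOf (_ , e , _) = star e

  isCentre-star : ∀ {i x y} → IsCentre i x → (e : Edge i x y) → x ≡ centre i (star e)
  isCentre-star {i} (_ , e₀ , x-centre) e =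
    trans x-centre (cong (centre i) (touching-sameStar (inj₁ (inj₁ refl)) e₀ e))

  centres-touching : ∀ {i x y x′ y′} → IsCentre i x → IsCentre i x′ →
    (e : Edge i x y) (e′ : Edge i x′ y′) → Touch x y x′ y′ → x ≡ x′
  centres-touching {i} cx cx′ e e′ touch =
    trans (isCentre-star cx e)
      (trans (cong (centre i) (touching-sameStar touch e e′)) (sym (isCentre-star cx′ e′)))

  centres-adjacent : ∀ {i x y} → IsCentre i x → IsCentre i y → c x y ≡ i → x ≡ y
  centres-adjacent {x = x} {y} cx cy cxy≡i with x ≟ y
  ... | yes x≡y = x≡y
  ... | no  x≢y = centres-touching cx cy (x≢y , cxy≡i) (Edge-flip (x≢y , cxy≡i)) (inj₁ (inj₂ refl))

  centres-commonNeighbour : ∀ {i x y w} → IsCentre i x → IsCentre i y →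
    x ≢ w → y ≢ w → c x w ≡ i → c y w ≡ i → x ≡ y
  centres-commonNeighbour cx cy x≢w y≢w cxw≡i cyw≡i =
    centres-touching cx cy (x≢w , cxw≡i) (y≢w , cyw≡i) (inj₂ (inj₂ refl))

  edge-hasCentre : ∀ {x y} → x ≢ y → IsCentre (c x y) x ⊎ IsCentre (c x y) y
  edge-hasCentre {x} {y} x≢y = fromStar (star-centred e)
    where
    e : Edge (c x y) x y
    e = x≢y , refl
    fromStar : x ≡ centre (c x y) (star e) ⊎ y ≡ centre (c x y) (star e) →
      IsCentre (c x y) x ⊎ IsCentre (c x y) y
    fromStar (inj₁ x-centre) = inj₁ (y , e , x-centre)
    fromStar (inj₂ y-centre) = inj₂ (x , Edge-flip e , trans y-centre
      (cong (centre (c x y)) (touching-sameStar (inj₂ (inj₁ refl)) e (Edge-flip e))))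

  isCentre? : ∀ i x → Dec (IsCentre i x)
  isCentre? i x = any? centredEdge?
    where
    centredEdge? : ∀ y → Dec (Σ (Edge i x y) λ e → x ≡ centre i (star e))
    centredEdge? y with x ≟ y | c x y ≟ i
    ... | yes x≡y | _        = no λ ((x≢y , _) , _) → x≢y x≡y
    ... | no  _   | no  cxy≢i = no λ ((_ , cxy≡i) , _) → cxy≢i cxy≡i
    ... | no  x≢y | yes cxy≡i =
      map′ (λ x-centre → e , x-centre)
           (λ (e′ , x-centre) →
              trans x-centre (cong (centre i) (touching-sameStar (inj₁ (inj₁ refl)) e′ e)))
           (x ≟ centre i (star e))
      where
      e : Edge i x y
      e = x≢y , cxy≡i

  noncentre-bound : ∀ z → ¬ (∃ λ i → IsCentre i z) → n ≤ suc m
  noncentre-bound z z-noncentre = injective⇒≤ label-injective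
    where
    centre-toward-z : ∀ {v} (v≢z : v ≢ z) → IsCentre (c v z) v
    centre-toward-z v≢z with edge-hasCentre v≢z
    ... | inj₁ v-centre = v-centre
    ... | inj₂ z-centre = ⊥-elim (z-noncentre (_ , z-centre))
    label : Fin n → Fin (suc m)
    label v with v ≟ z
    ... | yes _ = zero
    ... | no  _ = suc (c v z)
    label-injective : Injective _≡_ _≡_ label
    label-injective {v} {v′} eq with v ≟ z | v′ ≟ z
    ... | yes v≡z | yes v′≡z = trans v≡z (sym v′≡z)
    ... | no  v≢z | no  v′≢z =
      centres-commonNeighbour (centre-toward-z v≢z)
        (subst (λ i → IsCentre i v′) (sym colours) (centre-toward-z v′≢z)) v≢z v′≢z refl (sym colours)
      where
      colours : c v z ≡ c v′ z
      colours = suc-injective eq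

  centredForests : Fin n → List (Fin m)
  centredForests x = filter (λ i → isCentre? i x) (allFin m)

  centredForests-unique : ∀ x → Unique (centredForests x)
  centredForests-unique x = filter⁺ (λ i → isCentre? i x) (allFin⁺ m)

  ∈-centredForests : ∀ {i x xs} → centredForests x ≡ xs → i ∈ xs → IsCentre i x
  ∈-centredForests {x = x} refl i∈ = proj₂ (∈-filter⁻ (λ i → isCentre? i x) {xs = allFin m} i∈)

  centredForests-∈ : ∀ {i x xs} → centredForests x ≡ xs → IsCentre i x → i ∈ xs
  centredForests-∈ {i} {x} refl cx = ∈-filter⁺ (λ i → isCentre? i x) (∈-allFin i) cx

  Sole : Fin m → Fin n → Set
  Sole i x = centredForests x ≡ [ i ]

  sole-unique : ∀ {i u u′} → Sole i u → Sole i u′ → u ≡ u′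
  sole-unique {i} {u} {u′} su su′ with u ≟ u′
  ... | yes u≡u′ = u≡u′
  ... | no  u≢u′ =
    centres-adjacent (∈-centredForests su (here refl)) (∈-centredForests su′ (here refl)) cuu′≡i
    where
    cuu′≡i : c u u′ ≡ i
    cuu′≡i with edge-hasCentre u≢u′
    ... | inj₁ u-centre  with here p ← centredForests-∈ su u-centre = p
    ... | inj₂ u′-centre with here p ← centredForests-∈ su′ u′-centre = p

  colour-toSole : ∀ {i i′ u v} → IsCentre i v → (∀ {j} → IsCentre j v → j ≡ i ⊎ j ≡ i′) →
    Sole i u → v ≢ u → c v u ≡ i′
  colour-toSole cv v-forests su v≢u with edge-hasCentre v≢u
  ... | inj₂ u-centre with here cvu≡i ← centredForests-∈ su u-centre =
    ⊥-elim (v≢u (centres-adjacent cv (∈-centredForests su (here refl)) cvu≡i))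
  ... | inj₁ v-centre with v-forests v-centre
  ...   | inj₁ cvu≡i  = ⊥-elim (v≢u (centres-adjacent cv (∈-centredForests su (here refl)) cvu≡i))
  ...   | inj₂ cvu≡i′ = cvu≡i′

  -- The edges from v to u₁ and u₂ get colours i₂ and i₁, leaving no colour for the edge u₁u₂.
  notBothSole : ∀ {v i₁ i₂ u₁ u₂} → centredForests v ≡ i₁ ∷ i₂ ∷ [] → Sole i₁ u₁ → Sole i₂ u₂ → ⊥
  notBothSole {v} {i₁} {i₂} {u₁} {u₂} forests-v s₁ s₂ = separate (u₁ ≟ u₂)
    where
    cv : ∀ {j} → j ∈ i₁ ∷ i₂ ∷ [] → IsCentre j v
    cv = ∈-centredForests forests-v
    v-forests : ∀ {j} → IsCentre j v → j ≡ i₁ ⊎ j ≡ i₂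
    v-forests cj with centredForests-∈ forests-v cj
    ... | here j≡i₁         = inj₁ j≡i₁
    ... | there (here j≡i₂) = inj₂ j≡i₂
    v≢u₁ : v ≢ u₁
    v≢u₁ refl with () ← trans (sym forests-v) s₁
    v≢u₂ : v ≢ u₂
    v≢u₂ refl with () ← trans (sym forests-v) s₂
    cvu₁≡i₂ : c v u₁ ≡ i₂
    cvu₁≡i₂ = colour-toSole (cv (here refl)) v-forests s₁ v≢u₁
    cvu₂≡i₁ : c v u₂ ≡ i₁
    cvu₂≡i₁ = colour-toSole (cv (there (here refl))) (swap ∘ v-forests) s₂ v≢u₂
    separate : Dec (u₁ ≡ u₂) → ⊥
    separate (yes refl) with (i₁≢i₂ ∷ _) ∷ _ ← subst Unique forests-v (centredForests-unique v) =
      i₁≢i₂ (List.∷-injectiveˡ (trans (sym s₁) s₂))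
    separate (no u₁≢u₂) with edge-hasCentre u₁≢u₂
    ... | inj₁ u₁-centre with here cu₁u₂≡i₁ ← centredForests-∈ s₁ u₁-centre =
      v≢u₁ (sym (centres-commonNeighbour (∈-centredForests s₁ (here refl)) (cv (here refl))
        u₁≢u₂ v≢u₂ cu₁u₂≡i₁ cvu₂≡i₁))
    ... | inj₂ u₂-centre with here cu₁u₂≡i₂ ← centredForests-∈ s₂ u₂-centre =
      v≢u₂ (sym (centres-commonNeighbour (∈-centredForests s₂ (here refl)) (cv (there (here refl)))
        (u₁≢u₂ ∘ sym) v≢u₁ (trans (c-sym u₂ u₁ (u₁≢u₂ ∘ sym)) cu₁u₂≡i₂) cvu₁≡i₂))

  -- Forest i has the tokens (i , inj₁ a), one for each star a, and the spare tokens (i , inj₂ h).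
  Token : Set
  Token = Fin m × (Fin 2 ⊎ Fin 2)

  data Claims (v : Fin n) : Token → Set where
    star-token  : ∀ {i} (cv : IsCentre i v) → Claims v (i , inj₁ (starOf cv))
    sole-token  : ∀ {i} → Sole i v → ∀ h → Claims v (i , inj₂ h)
    spare-token : ∀ {i} (cv : IsCentre i v) → (∀ u → ¬ Sole i u) → Claims v (i , inj₂ (starOf cv))

  starOf-injective : ∀ {i v v′} (cv : IsCentre i v) (cv′ : IsCentre i v′) →
    starOf cv ≡ starOf cv′ → v ≡ v′
  starOf-injective {i} (_ , _ , v-centre) (_ , _ , v′-centre) sameStar =
    trans v-centre (trans (cong (centre i) sameStar) (sym v′-centre))

  claims-functional : ∀ {v v′ t t′} → Claims v t → Claims v′ t′ → t ≡ t′ → v ≡ v′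
  claims-functional (star-token cv) (star-token cv′) eq with refl ← cong proj₁ eq =
    starOf-injective cv cv′ (inj₁-injective (cong proj₂ eq))
  claims-functional (sole-token sv _) (sole-token sv′ _) eq with refl ← cong proj₁ eq =
    sole-unique sv sv′
  claims-functional {v = v} (sole-token sv _) (spare-token _ nonSole) eq with refl ← cong proj₁ eq =
    ⊥-elim (nonSole v sv)
  claims-functional {v′ = v′} (spare-token _ nonSole) (sole-token sv′ _) eq with refl ← cong proj₁ eq =
    ⊥-elim (nonSole v′ sv′)
  claims-functional (spare-token cv _) (spare-token cv′ _) eq with refl ← cong proj₁ eq =
    starOf-injective cv cv′ (inj₂-injective (cong proj₂ eq))

  Tokens : Fin n → Set
  Tokens v = Σ (Fin 3 → Token) λ g → Injective _≡_ _≡_ g × (∀ k → Claims v (g k))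

  threeTokens : ∀ {v a b d} → Claims v a → Claims v b → Claims v d →
    a ≢ b → a ≢ d → b ≢ d → Tokens v
  threeTokens ca cb cd a≢b a≢d b≢d = three _ _ _ , three-injective a≢b a≢d b≢d , claimed
    where
    claimed : ∀ k → Claims _ (three _ _ _ k)
    claimed 0F = ca
    claimed 1F = cb
    claimed 2F = cd

  forest-distinct : ∀ {i i′ a a′} → i ≢ i′ → _≢_ {A = Token} (i , a) (i′ , a′)
  forest-distinct i≢i′ eq = i≢i′ (cong proj₁ eq)

  sole? : ∀ i → Dec (∃ λ u → Sole i u)
  sole? i = any? λ u → List.≡-dec _≟_ (centredForests u) [ i ]

  tokens : ∀ v → (∃ λ i → IsCentre i v) → Tokens v
  tokens v (_ , cv) = fromList (centredForests v) refl (centredForests-unique v)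
    where
    fromList : ∀ xs → centredForests v ≡ xs → Unique xs → Tokens v
    fromList [] forests-v _ with () ← centredForests-∈ forests-v cv
    fromList (i ∷ []) forests-v _ =
      threeTokens (sole-token forests-v 0F) (sole-token forests-v 1F)
        (star-token (∈-centredForests forests-v (here refl))) (λ ()) (λ ()) (λ ())
    fromList (i₁ ∷ i₂ ∷ []) forests-v ((i₁≢i₂ ∷ _) ∷ _) = fromTwo (sole? i₁) (sole? i₂)
      where
      c₁ : IsCentre i₁ v
      c₁ = ∈-centredForests forests-v (here refl)
      c₂ : IsCentre i₂ v
      c₂ = ∈-centredForests forests-v (there (here refl))
      fromTwo : Dec (∃ λ u → Sole i₁ u) → Dec (∃ λ u → Sole i₂ u) → Tokens v
      fromTwo (no nonSole₁) _ =
        threeTokens (star-token c₁) (star-token c₂) (spare-token c₁ λ u s → nonSole₁ (u , s))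
          (forest-distinct i₁≢i₂) (λ ()) (forest-distinct (i₁≢i₂ ∘ sym))
      fromTwo _ (no nonSole₂) =
        threeTokens (star-token c₁) (star-token c₂) (spare-token c₂ λ u s → nonSole₂ (u , s))
          (forest-distinct i₁≢i₂) (forest-distinct i₁≢i₂) (λ ())
      fromTwo (yes (_ , s₁)) (yes (_ , s₂)) = ⊥-elim (notBothSole forests-v s₁ s₂)
    fromList (i₁ ∷ i₂ ∷ i₃ ∷ is) forests-v ((i₁≢i₂ ∷ i₁≢i₃ ∷ _) ∷ (i₂≢i₃ ∷ _) ∷ _) =
      threeTokens (star-token (centres (here refl))) (star-token (centres (there (here refl))))
        (star-token (centres (there (there (here refl)))))
        (forest-distinct i₁≢i₂) (forest-distinct i₁≢i₃) (forest-distinct i₂≢i₃)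
      where
      centres : ∀ {j} → j ∈ i₁ ∷ i₂ ∷ i₃ ∷ is → IsCentre j v
      centres = ∈-centredForests forests-v

  allCentres-bound : (∀ v → ∃ λ i → IsCentre i v) → n * 3 ≤ m * 4
  allCentres-bound centred =
    injective⇒≤ (Injection.injective (toFin ↣-∘ (tokenise ↣-∘ ↔⇒↣ *↔×)))
    where
    tokenise : (Fin n × Fin 3) ↣ Token
    tokenise = mk↣ (claims-injective Claims (λ cv cv′ → claims-functional cv cv′ refl)
      (λ v → proj₁ (tokens v (centred v)))
      (λ v → proj₁ (proj₂ (tokens v (centred v))))
      (λ v → proj₂ (proj₂ (tokens v (centred v)))))
    toFin : Token ↣ Fin (m * 4)
    toFin = ↔⇒↣ (↔-sym ((↔-id _ ×-↔ +↔⊎) ↔-∘ *↔×))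

  lower-bound : n ≤ suc m ⊎ n * 3 ≤ m * 4
  lower-bound with any? (λ z → ¬? (any? λ i → isCentre? i z))
  ... | yes (z , noncentre) = inj₁ (noncentre-bound z noncentre)
  ... | no  noNoncentre     = inj₂ (allCentres-bound λ v →
    decidable-stable (any? λ i → isCentre? i v) (λ noncentre → noNoncentre (v , noncentre)))

partition-lowerBound : ∀ {n m} → PartitionableInto2StarForests n m → n ≤ suc m ⊎ n * 3 ≤ m * 4
partition-lowerBound (c , c-sym , forest) = Centres.lower-bound c c-sym forest

theorem2 : (n : ℕ) → 3 < n →
    PartitionableInto2StarForests n (ceil3n/4 n)
    × ((m : ℕ) → PartitionableInto2StarForests n m → ceil3n/4 n ≤ m)
theorem2 n 3<n = partitionable-ceil3n/4 n , lower
  where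
  lower : (m : ℕ) → PartitionableInto2StarForests n m → ceil3n/4 n ≤ m
  lower m partition with partition-lowerBound partition
  ... | inj₁ n≤1+m = ceil3n/4-least {n} (n≤1+m⇒n*3≤m*4 3<n n≤1+m)
  ... | inj₂ n*3≤m*4 = ceil3n/4-least {n} n*3≤m*4
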